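{- Let $n\geq 1$ be an integer and define \[ B(n):=\sum_{j=1}^{2n+1}\binom{2n+j-1}{2n}\binom{4n-j+1}{2n}. \] Then for all integers $k$ with $1\leq k\leq n$, \[ \frac{1}{B(n)}\binom{2n+2k-1}{2n}\binom{4n-2k+1}{2n}=\frac{1}{6n+1}\cdot\frac{(4n+1)!}{(2n)!^2}\cdot\frac{\binom{2n}{2k-1}}{\binom{6n}{2n+2k-1}}. \] -}

module Defs where

open import Data.Nat using (ℕ; zero; suc; _+_; _*_; _∸_; _!)
open import Data.Nat.Combinatorics using (_C_)
open import Data.Rational using (ℚ; 0ℚ; normalize)

sumFrom1 : ℕ → (ℕ → ℕ) → ℕ
sumFrom1 zero    f = 0
sumFrom1 (suc m) f = sumFrom1 m f + f (suc m)

B : ℕ → ℕ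
B n = sumFrom1 (2 * n + 1) (λ j → ((2 * n + j ∸ 1) C (2 * n)) * ((4 * n + 1 ∸ j) C (2 * n)))

-- the rational number a/b for natural numbers a, b; a/0 is set to 0
-- (only used where the denominator is shown nonzero in the statement)
_÷ℕ_ : ℕ → ℕ → ℚ
a ÷ℕ zero  = 0ℚ
a ÷ℕ suc b = normalize a (suc b)

infix 6 _÷ℕ_

module Submission where

-- Write N = 2n.  The proof has two independent halves.
--
-- Reindexing j = i + 1 turns B(n) into the
--     convolution  Σ_{i+t=N} C(N+i,N) C(N+t,N),  and the shifted
--     Chu–Vandermonde identity
--         Σ_{i+t=m} C(a+i,a) C(b+t,b) = C(a+m+b+1, a+b+1)
--     gives B(n) = C(3N+1, 2N+1) = C(6n+1, 4n+1).  The shifted identity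
--     comes from the plain one,  Σ_{i+t=m} C(i,a) C(t,b) = C(m+1, a+b+1)
--     (induction on m and b via Pascal's rule), by discarding the
--     vanishing terms C(i,a) with i < a and C(t,b) with t < b.
--
-- With N = a + d (for the theorem a = 2k-1 and
--     d = N-a) every binomial coefficient in the claim is a quotient of
--     factorials, C(a+b,a)·a!·b! = (a+b)!.  After cross-multiplying, the
--     claim is an identity in ℕ which, multiplied by a!d!(N+a)!(N+d)!,
--     reduces both sides to (N+a)!(N+d)!(3N+1)!.

open import Defs
open import Data.Nat using (ℕ; _+_; _*_; _∸_; _!; _≤_)
open import Data.Nat.Combinatorics using (_C_)
open import Data.Product using (_×_)
open import Relation.Binary.PropositionalEquality using (_≡_; _≢_)
import Data.Rational as ℚ

open import Data.Product using (_,_)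
open import Data.Sum using (inj₁; inj₂)
open import Data.Nat using (zero; suc; NonZero; _<_; z≤n; s≤s; ≢-nonZero⁻¹)
open import Data.Nat.Properties
open import Data.Nat.Combinatorics
  using (nCk≡n!/k![n-k]!; k![n∸k]!∣n!; k>n⇒nCk≡0; nCk+nC[k+1]≡[n+1]C[k+1])
open import Data.Nat.DivMod using (m/n*n≡m)
open import Data.Nat.Tactic.RingSolver using (solve-∀)
open import Data.Integer using (+_)
import Data.Integer as ℤ
open import Data.Integer.Properties using (pos-*)
import Data.Rational.Properties as ℚP
import Data.Rational.Unnormalised as ℚᵘ
import Data.Rational.Unnormalised.Properties as ℚᵘP
open import Relation.Binary.PropositionalEquality
  using (refl; sym; trans; cong; cong₂; subst; subst₂; module ≡-Reasoning)
open import Relation.Nullary using (contradiction)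

binomial-factorial : ∀ a b → ((a + b) C a) * (a ! * b !) ≡ (a + b) !
binomial-factorial a b = begin
  ((a + b) C a) * (a ! * b !)
    ≡⟨ cong (λ x → ((a + b) C a) * (a ! * x !)) (sym (m+n∸m≡n a b)) ⟩
  ((a + b) C a) * (a ! * (a + b ∸ a) !)
    ≡⟨ cong (_* (a ! * (a + b ∸ a) !)) (nCk≡n!/k![n-k]! a≤a+b) ⟩
  ((a + b) ! / (a ! * (a + b ∸ a) !)) * (a ! * (a + b ∸ a) !)
    ≡⟨ m/n*n≡m (k![n∸k]!∣n! a≤a+b) ⟩
  (a + b) ! ∎
  where
  open ≡-Reasoning
  open Data.Nat.DivMod using (_/_)
  a≤a+b : a ≤ a + b
  a≤a+b = m≤m+n a b
  instance
    a!b!≢0 : NonZero (a ! * (a + b ∸ a) !)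
    a!b!≢0 = a !* (a + b ∸ a) !≢0

factorial-nonzero : ∀ n → n ! ≢ 0
factorial-nonzero n = ≢-nonZero⁻¹ (n !) {{n !≢0}}

product-nonzero : ∀ {m n} → m ≢ 0 → n ≢ 0 → m * n ≢ 0
product-nonzero {m} m≢0 n≢0 mn≡0 with m*n≡0⇒m≡0∨n≡0 m mn≡0
... | inj₁ m≡0 = m≢0 m≡0
... | inj₂ n≡0 = n≢0 n≡0

binomial-nonzero : ∀ a b → (a + b) C a ≢ 0
binomial-nonzero a b C≡0 = factorial-nonzero (a + b) (begin
  (a + b) !                   ≡⟨ sym (binomial-factorial a b) ⟩
  ((a + b) C a) * (a ! * b !) ≡⟨ cong (_* (a ! * b !)) C≡0 ⟩
  0                           ∎)
  where open ≡-Reasoning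

-- conv f g m = Σ_{i+t=m} f i · g t; the recursion splits off the term i = m.
conv : (ℕ → ℕ) → (ℕ → ℕ) → ℕ → ℕ
conv f g zero    = f 0 * g 0
conv f g (suc m) = conv f (λ t → g (suc t)) m + f (suc m) * g 0

conv-+ : ∀ f m {g h₁ h₂} → (∀ t → g t ≡ h₁ t + h₂ t) →
         conv f g m ≡ conv f h₁ m + conv f h₂ m
conv-+ f zero    {g} {h₁} {h₂} g≡h₁+h₂ =
  trans (cong (f 0 *_) (g≡h₁+h₂ 0)) (*-distribˡ-+ (f 0) (h₁ 0) (h₂ 0))
conv-+ f (suc m) {g} {h₁} {h₂} g≡h₁+h₂ = begin
  conv f (λ t → g (suc t)) m + f (suc m) * g 0
    ≡⟨ cong₂ _+_ (conv-+ f m (λ t → g≡h₁+h₂ (suc t)))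
                 (trans (cong (f (suc m) *_) (g≡h₁+h₂ 0)) (*-distribˡ-+ (f (suc m)) (h₁ 0) (h₂ 0))) ⟩
  (conv f (λ t → h₁ (suc t)) m + conv f (λ t → h₂ (suc t)) m)
    + (f (suc m) * h₁ 0 + f (suc m) * h₂ 0)
    ≡⟨ +-interchange (conv f (λ t → h₁ (suc t)) m) (conv f (λ t → h₂ (suc t)) m) _ _ ⟩
  conv f h₁ (suc m) + conv f h₂ (suc m) ∎
  where
  open ≡-Reasoning
  +-interchange : ∀ w x y z → (w + x) + (y + z) ≡ (w + y) + (x + z)
  +-interchange = solve-∀

-- Chu–Vandermonde:  Σ_{i+t=m} C(i,a) C(t,b) = C(m+1, a+b+1),
-- by induction on m and b using Pascal's rule in the second factor.
vandermonde : ∀ a b m → conv (_C a) (_C b) m ≡ suc m C suc (a + b)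
vandermonde zero    zero    zero    = refl
vandermonde zero    (suc b) zero    = refl
vandermonde (suc a) b       zero    = refl
vandermonde a       zero    (suc m) = begin
  conv (_C a) (_C 0) m + (suc m C a) * 1
    ≡⟨ cong₂ _+_ (vandermonde a 0 m) (*-identityʳ (suc m C a)) ⟩
  (suc m C suc (a + 0)) + (suc m C a)
    ≡⟨ cong (λ x → (suc m C suc x) + (suc m C a)) (+-identityʳ a) ⟩
  (suc m C suc a) + (suc m C a)
    ≡⟨ +-comm (suc m C suc a) (suc m C a) ⟩
  (suc m C a) + (suc m C suc a)
    ≡⟨ nCk+nC[k+1]≡[n+1]C[k+1] (suc m) a ⟩
  suc (suc m) C suc a
    ≡⟨ cong (λ x → suc (suc m) C suc x) (sym (+-identityʳ a)) ⟩
  suc (suc m) C suc (a + 0) ∎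
  where open ≡-Reasoning
vandermonde a       (suc b) (suc m) = begin
  conv (_C a) (λ t → suc t C suc b) m + (suc m C a) * 0
    ≡⟨ cong₂ _+_ (conv-+ (_C a) m (λ t → sym (nCk+nC[k+1]≡[n+1]C[k+1] t b)))
                 (*-zeroʳ (suc m C a)) ⟩
  (conv (_C a) (_C b) m + conv (_C a) (_C suc b) m) + 0
    ≡⟨ +-identityʳ _ ⟩
  conv (_C a) (_C b) m + conv (_C a) (_C suc b) m
    ≡⟨ cong₂ _+_ (vandermonde a b m) (vandermonde a (suc b) m) ⟩
  (suc m C suc (a + b)) + (suc m C suc (a + suc b))
    ≡⟨ cong (λ x → (suc m C suc (a + b)) + (suc m C suc x)) (+-suc a b) ⟩
  (suc m C suc (a + b)) + (suc m C suc (suc (a + b)))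
    ≡⟨ nCk+nC[k+1]≡[n+1]C[k+1] (suc m) (suc (a + b)) ⟩
  suc (suc m) C suc (suc (a + b))
    ≡⟨ cong (λ x → suc (suc m) C suc x) (sym (+-suc a b)) ⟩
  suc (suc m) C suc (a + suc b) ∎
  where open ≡-Reasoning

conv-vanishing : ∀ f m g → (∀ i → i ≤ m → f i ≡ 0) → conv f g m ≡ 0
conv-vanishing f zero    g f≡0 = cong (_* g 0) (f≡0 0 z≤n)
conv-vanishing f (suc m) g f≡0 =
  cong₂ _+_ (conv-vanishing f m _ (λ i i≤m → f≡0 i (m≤n⇒m≤1+n i≤m)))
            (cong (_* g 0) (f≡0 (suc m) ≤-refl))

conv-last-term : ∀ f a g → (∀ i → i < a → f i ≡ 0) → conv f g a ≡ f a * g 0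
conv-last-term f zero    g f≡0 = refl
conv-last-term f (suc a) g f≡0 =
  cong (_+ f (suc a) * g 0) (conv-vanishing f a _ (λ i i≤a → f≡0 i (s≤s i≤a)))

conv-drop-left : ∀ f a → (∀ i → i < a → f i ≡ 0) →
                 ∀ m g → conv f g (a + m) ≡ conv (λ i → f (a + i)) g m
conv-drop-left f a f≡0 zero    g rewrite +-identityʳ a = conv-last-term f a g f≡0
conv-drop-left f a f≡0 (suc m) g rewrite +-suc a m =
  cong (_+ f (suc (a + m)) * g 0) (conv-drop-left f a f≡0 m _)

conv-drop-right : ∀ f b g → (∀ t → t < b → g t ≡ 0) →
                  ∀ m → conv f g (m + b) ≡ conv f (λ t → g (b + t)) m
conv-drop-right f zero    g g≡0 m rewrite +-identityʳ m = refl
conv-drop-right f (suc b) g g≡0 m rewrite +-suc m b = begin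
  conv f (λ t → g (suc t)) (m + b) + f (suc (m + b)) * g 0
    ≡⟨ cong₂ _+_ (conv-drop-right f b _ (λ t t<b → g≡0 (suc t) (s≤s t<b)) m)
                 (trans (cong (f (suc (m + b)) *_) (g≡0 0 (s≤s z≤n))) (*-zeroʳ (f (suc (m + b))))) ⟩
  conv f (λ t → g (suc (b + t))) m + 0
    ≡⟨ +-identityʳ _ ⟩
  conv f (λ t → g (suc (b + t))) m ∎
  where open ≡-Reasoning

-- Shifted Chu–Vandermonde:  Σ_{i+t=m} C(a+i,a) C(b+t,b) = C(a+m+b+1, a+b+1),
-- the plain identity with the vanishing terms C(i,a), i < a, and C(t,b), t < b, removed.
shifted-vandermonde : ∀ a b m →
  conv (λ i → (a + i) C a) (λ t → (b + t) C b) m ≡ suc (a + m + b) C suc (a + b)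
shifted-vandermonde a b m = begin
  conv (λ i → (a + i) C a) (λ t → (b + t) C b) m
    ≡⟨ sym (conv-drop-left (_C a) a (λ i → k>n⇒nCk≡0) m _) ⟩
  conv (_C a) (λ t → (b + t) C b) (a + m)
    ≡⟨ sym (conv-drop-right (_C a) b (_C b) (λ t → k>n⇒nCk≡0) (a + m)) ⟩
  conv (_C a) (_C b) (a + m + b)
    ≡⟨ vandermonde a b (a + m + b) ⟩
  suc (a + m + b) C suc (a + b) ∎
  where open ≡-Reasoning

sumFrom1-cong : ∀ M φ ψ → (∀ j → 1 ≤ j → j ≤ M → φ j ≡ ψ j) → sumFrom1 M φ ≡ sumFrom1 M ψ
sumFrom1-cong zero    φ ψ φ≡ψ = refl
sumFrom1-cong (suc M) φ ψ φ≡ψ =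
  cong₂ _+_ (sumFrom1-cong M φ ψ (λ j 1≤j j≤M → φ≡ψ j 1≤j (m≤n⇒m≤1+n j≤M)))
            (φ≡ψ (suc M) (s≤s z≤n) ≤-refl)

conv-as-sum : ∀ f g m → conv f g m ≡ sumFrom1 (suc m) (λ j → f (j ∸ 1) * g (suc m ∸ j))
conv-as-sum f g zero    = refl
conv-as-sum f g (suc m) =
  cong₂ _+_ (trans (conv-as-sum f _ m)
                   (sumFrom1-cong (suc m) _ _
                     (λ j _ j≤1+m → cong (λ x → f (j ∸ 1) * g x) (sym (+-∸-assoc 1 j≤1+m)))))
            (cong (λ x → f (suc m) * g x) (sym (n∸n≡0 m)))

-- Closed form of B(n):  B(n) = C(6n+1, 4n+1), written with N = 2n as C(3N+1, 2N+1).
-- B(n) is the convolution Σ_{i+t=N} C(N+i,N) C(N+t,N).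
B-closed : ∀ n → B n ≡ suc (2 * n + 2 * n + 2 * n) C suc (2 * n + 2 * n)
B-closed n = begin
  B n
    ≡⟨ cong (λ M → sumFrom1 M β) (+-comm N 1) ⟩
  sumFrom1 (suc N) β
    ≡⟨ sumFrom1-cong (suc N) β _ (λ j 1≤j j≤1+N →
         cong₂ (λ x y → (x C N) * (y C N))
               (+-∸-assoc N 1≤j)
               (trans (cong (_∸ j) (4n+1≡N+[1+N] n)) (+-∸-assoc N j≤1+N))) ⟩
  sumFrom1 (suc N) (λ j → F (j ∸ 1) * F (suc N ∸ j))
    ≡⟨ sym (conv-as-sum F F N) ⟩
  conv F F N
    ≡⟨ shifted-vandermonde N N N ⟩
  suc (N + N + N) C suc (N + N) ∎
  where
  open ≡-Reasoning
  N : ℕ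
  N = 2 * n
  β : ℕ → ℕ
  β j = ((2 * n + j ∸ 1) C (2 * n)) * ((4 * n + 1 ∸ j) C (2 * n))
  F : ℕ → ℕ
  F i = (N + i) C N
  4n+1≡N+[1+N] : ∀ n → 4 * n + 1 ≡ 2 * n + (1 + 2 * n)
  4n+1≡N+[1+N] = solve-∀

fromℚᵘ-homo-* : ∀ p q → ℚ.fromℚᵘ p ℚ.* ℚ.fromℚᵘ q ≡ ℚ.fromℚᵘ (p ℚᵘ.* q)
fromℚᵘ-homo-* p q = ℚP.toℚᵘ-injective (begin
  ℚ.toℚᵘ (ℚ.fromℚᵘ p ℚ.* ℚ.fromℚᵘ q)            ≈⟨ ℚP.toℚᵘ-homo-* (ℚ.fromℚᵘ p) (ℚ.fromℚᵘ q) ⟩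
  ℚ.toℚᵘ (ℚ.fromℚᵘ p) ℚᵘ.* ℚ.toℚᵘ (ℚ.fromℚᵘ q) ≈⟨ ℚᵘP.*-cong (ℚP.toℚᵘ-fromℚᵘ p) (ℚP.toℚᵘ-fromℚᵘ q) ⟩
  p ℚᵘ.* q                                        ≈⟨ ℚᵘP.≃-sym (ℚP.toℚᵘ-fromℚᵘ (p ℚᵘ.* q)) ⟩
  ℚ.toℚᵘ (ℚ.fromℚᵘ (p ℚᵘ.* q))                   ∎)
  where open ℚᵘP.≃-Reasoning

÷ℕ-cross : ∀ a b c d → b ≢ 0 → d ≢ 0 → a * d ≡ c * b → a ÷ℕ b ≡ c ÷ℕ d
÷ℕ-cross a zero    c d       b≢0 d≢0 ad≡cb = contradiction refl b≢0
÷ℕ-cross a (suc b) c zero    b≢0 d≢0 ad≡cb = contradiction refl d≢0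
÷ℕ-cross a (suc b) c (suc d) b≢0 d≢0 ad≡cb =
  ℚP.fromℚᵘ-cong {ℚᵘ.mkℚᵘ (+ a) b} {ℚᵘ.mkℚᵘ (+ c) d} (ℚᵘ.*≡* (begin
  + a ℤ.* + suc d ≡⟨ sym (pos-* a (suc d)) ⟩
  + (a * suc d)   ≡⟨ cong +_ ad≡cb ⟩
  + (c * suc b)   ≡⟨ pos-* c (suc b) ⟩
  + c ℤ.* + suc b ∎))
  where open ≡-Reasoning

÷ℕ-* : ∀ a b c d → b ≢ 0 → d ≢ 0 → (a ÷ℕ b) ℚ.* (c ÷ℕ d) ≡ (a * c) ÷ℕ (b * d)
÷ℕ-* a zero    c d       b≢0 d≢0 = contradiction refl b≢0
÷ℕ-* a (suc b) c zero    b≢0 d≢0 = contradiction refl d≢0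
÷ℕ-* a (suc b) c (suc d) b≢0 d≢0 =
  trans (fromℚᵘ-homo-* (ℚᵘ.mkℚᵘ (+ a) b) (ℚᵘ.mkℚᵘ (+ c) d))
        (ℚP.fromℚᵘ-cong (ℚᵘP.≃-reflexive (cong (λ x → ℚᵘ.mkℚᵘ x (d + b * suc d)) (sym (pos-* a c)))))

triple-split : ∀ N a d → N ≡ a + d → N + N + N ≡ (N + a) + (N + d)
triple-split .(a + d) a d refl = split a d
  where
  split : ∀ a d → (a + d) + (a + d) + (a + d) ≡ ((a + d) + a) + ((a + d) + d)
  split = solve-∀

middle-binomial-factorial : ∀ N a d → N ≡ a + d →
  ((N + N + N) C (N + a)) * ((N + a) ! * (N + d) !) ≡ (N + N + N) !
middle-binomial-factorial N a d N≡a+d =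
  subst (λ m → (m C (N + a)) * ((N + a) ! * (N + d) !) ≡ m !)
        (sym (triple-split N a d N≡a+d)) (binomial-factorial (N + a) (N + d))

middle-binomial-nonzero : ∀ N a d → N ≡ a + d → ((N + N + N) C (N + a)) ≢ 0
middle-binomial-nonzero N a d N≡a+d =
  subst (λ m → (m C (N + a)) ≢ 0) (sym (triple-split N a d N≡a+d)) (binomial-nonzero (N + a) (N + d))

-- After multiplying by a! d! (N+a)! (N+d)!, each binomial coefficient absorbs its
-- factorials and both sides become (N+a)! (N+d)! (3N+1)!.
cross-multiplied : ∀ N a d → N ≡ a + d →
  (((N + a) C N) * ((N + d) C N)) * ((suc (N + N + N) * (N ! * N !)) * ((N + N + N) C (N + a)))
  ≡ ((suc (N + N)) ! * (N C a)) * (suc (N + N + N) C suc (N + N))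
cross-multiplied .(a + d) a d refl =
  *-cancelʳ-≡ _ _ (a ! * d ! * X) {{m*n≢0 _ _ {{a !* d !≢0}} {{(N + a) !* (N + d) !≢0}}}}
    (trans left-side (sym right-side))
  where
  N N3 A₁ A₂ S R Bn X : ℕ
  N  = a + d
  N3 = N + N + N
  A₁ = (N + a) C N
  A₂ = (N + d) C N
  S  = N3 C (N + a)
  R  = (suc (N + N)) !
  Bn = suc N3 C suc (N + N)
  X  = (N + a) ! * (N + d) !

  regroup-left : ∀ p q m s n x y u v →
    ((p * q) * ((m * (n * n)) * s)) * ((x * y) * (u * v))
    ≡ ((p * (n * x)) * (q * (n * y))) * (m * (s * (u * v)))
  regroup-left = solve-∀

  regroup-right : ∀ r c b x y u → ((r * c) * b) * ((x * y) * u) ≡ u * (b * (r * (c * (x * y))))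
  regroup-right = solve-∀

  left-side : ((A₁ * A₂) * ((suc N3 * (N ! * N !)) * S)) * (a ! * d ! * X) ≡ X * (suc N3) !
  left-side = begin
    ((A₁ * A₂) * ((suc N3 * (N ! * N !)) * S)) * (a ! * d ! * X)
      ≡⟨ regroup-left A₁ A₂ (suc N3) S (N !) (a !) (d !) ((N + a) !) ((N + d) !) ⟩
    ((A₁ * (N ! * a !)) * (A₂ * (N ! * d !))) * (suc N3 * (S * X))
      ≡⟨ cong₂ _*_ (cong₂ _*_ (binomial-factorial N a) (binomial-factorial N d))
                   (cong (suc N3 *_) (middle-binomial-factorial N a d refl)) ⟩
    X * (suc N3) ! ∎
    where open ≡-Reasoning

  right-side : ((R * (N C a)) * Bn) * (a ! * d ! * X) ≡ X * (suc N3) !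
  right-side = begin
    ((R * (N C a)) * Bn) * (a ! * d ! * X)
      ≡⟨ regroup-right R (N C a) Bn (a !) (d !) X ⟩
    X * (Bn * (R * ((N C a) * (a ! * d !))))
      ≡⟨ cong (λ y → X * (Bn * (R * y))) (binomial-factorial a d) ⟩
    X * (Bn * (R * N !))
      ≡⟨ cong (X *_) (binomial-factorial (suc (N + N)) N) ⟩
    X * (suc N3) ! ∎
    where open ≡-Reasoning

ratio-identity : ∀ N a d → N ≡ a + d →
  (((N + a) C N) * ((N + d) C N)) ÷ℕ (suc (N + N + N) C suc (N + N))
  ≡ (1 ÷ℕ suc (N + N + N)) ℚ.* ((suc (N + N)) ! ÷ℕ (N ! * N !))
      ℚ.* ((N C a) ÷ℕ ((N + N + N) C (N + a)))
ratio-identity N a d N≡a+d = begin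
  X ÷ℕ Bn
    ≡⟨ ÷ℕ-cross X Bn (R * (N C a)) ((suc N3 * Q) * S) Bn≢0
                (product-nonzero [3N+1]Q≢0 S≢0)
                (cross-multiplied N a d N≡a+d) ⟩
  (R * (N C a)) ÷ℕ ((suc N3 * Q) * S)
    ≡⟨ cong (λ r → (r * (N C a)) ÷ℕ ((suc N3 * Q) * S)) (sym (*-identityˡ R)) ⟩
  ((1 * R) * (N C a)) ÷ℕ ((suc N3 * Q) * S)
    ≡⟨ sym (÷ℕ-* (1 * R) (suc N3 * Q) (N C a) S [3N+1]Q≢0 S≢0) ⟩
  ((1 * R) ÷ℕ (suc N3 * Q)) ℚ.* ((N C a) ÷ℕ S)
    ≡⟨ cong (ℚ._* ((N C a) ÷ℕ S)) (sym (÷ℕ-* 1 (suc N3) R Q (λ ()) Q≢0)) ⟩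
  (1 ÷ℕ suc N3) ℚ.* (R ÷ℕ Q) ℚ.* ((N C a) ÷ℕ S) ∎
  where
  open ≡-Reasoning
  N3 X Bn R Q S : ℕ
  N3 = N + N + N
  X  = ((N + a) C N) * ((N + d) C N)
  Bn = suc N3 C suc (N + N)
  R  = (suc (N + N)) !
  Q  = N ! * N !
  S  = N3 C (N + a)
  Bn≢0 : Bn ≢ 0
  Bn≢0 = binomial-nonzero (suc (N + N)) N
  Q≢0 : Q ≢ 0
  Q≢0 = product-nonzero (factorial-nonzero N) (factorial-nonzero N)
  S≢0 : S ≢ 0
  S≢0 = middle-binomial-nonzero N a d N≡a+d
  [3N+1]Q≢0 : suc N3 * Q ≢ 0
  [3N+1]Q≢0 = product-nonzero {suc N3} (λ ()) Q≢0

6n≡3N : ∀ n → 6 * n ≡ 2 * n + 2 * n + 2 * n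
6n≡3N = solve-∀

6n+1≡3N+1 : ∀ n → 6 * n + 1 ≡ suc (2 * n + 2 * n + 2 * n)
6n+1≡3N+1 = solve-∀

4n+1≡2N+1 : ∀ n → 4 * n + 1 ≡ suc (2 * n + 2 * n)
4n+1≡2N+1 = solve-∀

complement-index : ∀ N j → 1 ≤ j → j ∸ 1 ≤ N → suc (N + N) ∸ j ≡ N + (N ∸ (j ∸ 1))
complement-index N (suc a) _ a≤N = +-∸-assoc N a≤N

-- With N = 2n, a = 2k-1 and d = N - a, the statement is B(n) = C(3N+1,2N+1)
-- together with the ratio identity above, after rewriting its indices.
lemma2p3 : (n k : ℕ) → 1 ≤ n → 1 ≤ k → k ≤ n →
    (B n ≢ 0) × ((6 * n) C (2 * n + 2 * k ∸ 1) ≢ 0) ×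
    ((((2 * n + 2 * k ∸ 1) C (2 * n)) * ((4 * n + 1 ∸ 2 * k) C (2 * n))) ÷ℕ B n
      ≡ (1 ÷ℕ (6 * n + 1)) ℚ.* (((4 * n + 1) !) ÷ℕ ((2 * n) ! * (2 * n) !))
          ℚ.* (((2 * n) C (2 * k ∸ 1)) ÷ℕ ((6 * n) C (2 * n + 2 * k ∸ 1))))
lemma2p3 n k _ 1≤k k≤n = B≢0 , S≢0 , identity
  where
  N a d : ℕ
  N = 2 * n
  a = 2 * k ∸ 1
  d = N ∸ a

  1≤2k : 1 ≤ 2 * k
  1≤2k = ≤-trans 1≤k (m≤m+n k (k + 0))

  a≤N : a ≤ N
  a≤N = ≤-trans (m∸n≤m (2 * k) 1) (*-monoʳ-≤ 2 k≤n)

  N≡a+d : N ≡ a + d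
  N≡a+d = sym (m+[n∸m]≡n a≤N)

  B≢0 : B n ≢ 0
  B≢0 = subst (_≢ 0) (sym (B-closed n)) (binomial-nonzero (suc (N + N)) N)

  S≢0 : (6 * n) C (2 * n + 2 * k ∸ 1) ≢ 0
  S≢0 = subst₂ (λ m j → (m C j) ≢ 0) (sym (6n≡3N n)) (sym (+-∸-assoc N 1≤2k))
               (middle-binomial-nonzero N a d N≡a+d)

  identity : (((2 * n + 2 * k ∸ 1) C (2 * n)) * ((4 * n + 1 ∸ 2 * k) C (2 * n))) ÷ℕ B n
    ≡ (1 ÷ℕ (6 * n + 1)) ℚ.* (((4 * n + 1) !) ÷ℕ ((2 * n) ! * (2 * n) !))
        ℚ.* (((2 * n) C (2 * k ∸ 1)) ÷ℕ ((6 * n) C (2 * n + 2 * k ∸ 1)))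
  identity rewrite B-closed n | +-∸-assoc N 1≤2k | 6n+1≡3N+1 n | 4n+1≡2N+1 n
                 | complement-index N (2 * k) 1≤2k a≤N | 6n≡3N n
    = ratio-identity N a d N≡a+d
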